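{- Let $d$ be a positive integer and $G$ a graph with $\mathcal{R}_d(G)$ non-empty. Then $$\chi^=_d(G) = \min \{ \chi(G / H) \mid H \in \mathcal{R}_d(G) \}.$$
   Context: All graphs are finite, simple and undirected. An exact $(k,d)$-coloring of $G=(V,E)$ is a map $c: V\to\{1,\dots,k\}$ such that every vertex has exactly $d$ neighbors of its own color; $\chi_d^=(G)$ is the least $k$ for which one exists ($\infty$ if none). $\chi$ denotes the chromatic number. $\mathcal{R}_d(G)$ is the set of all partitions of $V$ into parts each inducing a $d$-regular subgraph of $G$. For $H \in \mathcal{R}_d(G)$, $G/H$ is the simple graph obtained from $G$ by replacing each part of $H$ by a single vertex, two such vertices being adjacent iff $G$ has an edge between the corresponding parts. -}

module Defs where

open import Data.Nat using (ℕ; zero; suc; _+_; _≤_)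
open import Data.Fin using (Fin; zero; suc; _≟_)
open import Data.Bool using (Bool; true; false; _∧_; _∨_; not; if_then_else_)
open import Data.Product using (Σ; _×_; ∃)
open import Relation.Nullary.Decidable using (⌊_⌋)
open import Relation.Binary.PropositionalEquality using (_≡_; _≢_)

record Graph : Set where
  field
    n   : ℕ
    adj : Fin n → Fin n → Bool

open Graph public

IsSimple : Graph → Set
IsSimple G = (∀ u v → adj G u v ≡ adj G v u) × (∀ v → adj G v v ≡ false)

_==_ : ∀ {k} → Fin k → Fin k → Bool
i == j = ⌊ i ≟ j ⌋

count : ∀ {m} → (Fin m → Bool) → ℕ
count {zero}  f = 0
count {suc m} f = (if f zero then 1 else 0) + count (λ i → f (suc i))

anyFin : ∀ {m} → (Fin m → Bool) → Bool
anyFin {zero}  f = false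
anyFin {suc m} f = f zero ∨ anyFin (λ i → f (suc i))

IsExactColoring : (G : Graph) (k d : ℕ) → (Fin (n G) → Fin k) → Set
IsExactColoring G k d c =
  ∀ v → count (λ u → adj G v u ∧ (c u == c v)) ≡ d

HasExactColoring : Graph → ℕ → ℕ → Set
HasExactColoring G k d = Σ (Fin (n G) → Fin k) (IsExactColoring G k d)

ExactChromaticNumberIs : Graph → ℕ → ℕ → Set
ExactChromaticNumberIs G d k =
  HasExactColoring G k d × (∀ k' → HasExactColoring G k' d → k ≤ k')

IsProperColoring : (G : Graph) (k : ℕ) → (Fin (n G) → Fin k) → Set
IsProperColoring G k c = ∀ u v → adj G u v ≡ true → c u ≢ c v

HasProperColoring : Graph → ℕ → Set
HasProperColoring G k = Σ (Fin (n G) → Fin k) (IsProperColoring G k)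

ChromaticNumberIs : Graph → ℕ → Set
ChromaticNumberIs G k =
  HasProperColoring G k × (∀ k' → HasProperColoring G k' → k ≤ k')

InducesRegular : (G : Graph) → (Fin (n G) → Bool) → ℕ → Set
InducesRegular G S d =
  ∀ v → S v ≡ true → count (λ u → S u ∧ adj G v u) ≡ d

record Partition (G : Graph) : Set where
  field
    parts : ℕ
    part  : Fin (n G) → Fin parts
    nonempty : ∀ (i : Fin parts) → ∃ λ v → part v ≡ i

open Partition public

partSet : {G : Graph} (H : Partition G) → Fin (parts H) → Fin (n G) → Bool
partSet H i v = part H v == i

InRd : (G : Graph) → ℕ → Partition G → Set
InRd G d H = ∀ (i : Fin (parts H)) → InducesRegular G (partSet H i) d

quotient : (G : Graph) → Partition G → Graph
quotient G H = record
  { n   = parts H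
  ; adj = λ i j → not (i == j) ∧
            anyFin (λ u → anyFin (λ v → partSet H i u ∧ partSet H j v ∧ adj G u v))
  }

MinQuotientChromaticIs : Graph → ℕ → ℕ → Set
MinQuotientChromaticIs G d k =
  (∃ λ (H : Partition G) → InRd G d H × ChromaticNumberIs (quotient G H) k)
  × (∀ (H : Partition G) (m : ℕ) → InRd G d H → ChromaticNumberIs (quotient G H) m → k ≤ m)

-- An exact colouring with the least number of colours uses every colour, so its
-- colour classes form some H ∈ R_d(G), and the identity properly colours G/H.
-- Conversely, a proper colouring of G/H pulled back to G is exact: a neighbour of v
-- in another part is a neighbour of v's part in G/H, hence differently coloured, so
-- the neighbours sharing v's colour are exactly its d neighbours in its own part. The least number of colours exists
-- constructively because any H ∈ R_d(G) bounds it and exactness is decidable.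
module Submission where

open import Defs
open import Data.Bool using (Bool; true; false; _∧_; _∨_; not; if_then_else_)
open import Data.Bool.Properties using (∧-comm; ∧-zeroʳ; ∧-identityʳ; ∨-zeroʳ)
open import Data.Fin using (Fin; zero; suc; _≟_; punchOut)
open import Data.Fin.Properties using (any?; all?; punchOut-cong; punchOut-injective)
open import Data.Nat using (ℕ; zero; suc; _+_; _≤_; _<_; _≥_)
open import Data.Nat.Properties using (≮⇒≥; ≤∧≢⇒<; ≤-pred; +-suc; +-identityʳ; n≮n)
import Data.Nat.Properties as ℕ
open import Data.Product using (Σ; _×_; ∃; _,_; proj₁)
open import Data.Vec.Functional using (_∷_; head; tail)
open import Data.Vec.Functional.Properties using (∷-cong)
open import Function using (id; _∘_)
open import Function.Bundles using (_⇔_; mk⇔)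
open import Relation.Nullary using (Dec; yes; no; ¬_; contradiction)
open import Relation.Nullary.Decidable using (isYes; does; isYes≗does; dec-true; dec-false; does-⇔; decidable-stable)
open import Relation.Unary using (Decidable)
open import Relation.Binary.PropositionalEquality

==-refl : ∀ {k} (i : Fin k) → (i == i) ≡ true
==-refl i = trans (isYes≗does (i ≟ i)) (dec-true (i ≟ i) refl)

==-≢ : ∀ {k} {i j : Fin k} → i ≢ j → (i == j) ≡ false
==-≢ {i = i} {j} i≢j = trans (isYes≗does (i ≟ j)) (dec-false (i ≟ j) i≢j)

==⇒≡ : ∀ {k} {i j : Fin k} → (i == j) ≡ true → i ≡ j
==⇒≡ {i = i} {j} i==j with i ≟ j
... | yes i≡j = i≡j
... | no _ = contradiction i==j λ ()

==-⇔ : ∀ {k l} {i j : Fin k} {i′ j′ : Fin l} → i ≡ j ⇔ i′ ≡ j′ → (i == j) ≡ (i′ == j′)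
==-⇔ {i = i} {j} {i′} {j′} i≡j⇔i′≡j′ = begin
  isYes (i ≟ j)    ≡⟨ isYes≗does (i ≟ j) ⟩
  does (i ≟ j)     ≡⟨ does-⇔ i≡j⇔i′≡j′ (i ≟ j) (i′ ≟ j′) ⟩
  does (i′ ≟ j′)   ≡⟨ isYes≗does (i′ ≟ j′) ⟨
  isYes (i′ ≟ j′)  ∎
  where open ≡-Reasoning

count-cong : ∀ {m} {f g : Fin m → Bool} → (∀ i → f i ≡ g i) → count f ≡ count g
count-cong {zero}  _   = refl
count-cong {suc m} f≗g =
  cong₂ _+_ (cong (λ b → if b then 1 else 0) (f≗g zero)) (count-cong (f≗g ∘ suc))

anyFin-witness : ∀ {m} (f : Fin m → Bool) (i : Fin m) → f i ≡ true → anyFin f ≡ true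
anyFin-witness f zero    fi = cong (_∨ anyFin (f ∘ suc)) fi
anyFin-witness f (suc i) fi =
  trans (cong (f zero ∨_) (anyFin-witness (f ∘ suc) i fi)) (∨-zeroʳ (f zero))

∃-Fin→Fin? : ∀ n {k} (P : (Fin n → Fin k) → Set) →
  (∀ {c c′} → c ≗ c′ → P c → P c′) → Decidable P → Dec (∃ P)
∃-Fin→Fin? zero P P-resp P? with P? (λ ())
... | yes p = yes (_ , p)
... | no ¬p = no λ (c , pc) → ¬p (P-resp (λ ()) pc)
∃-Fin→Fin? (suc n) P P-resp P? with any? extends?
  where
  extends? : ∀ a → Dec (∃ λ c → P (a ∷ c))
  extends? a = ∃-Fin→Fin? n (P ∘ (a ∷_)) (P-resp ∘ ∷-cong refl) (P? ∘ (a ∷_))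
... | yes (a , c , p) = yes (a ∷ c , p)
... | no ¬p = no λ (c , pc) → ¬p (head c , tail c , P-resp (∷-cong refl λ _ → refl) pc)

IsLeast : (ℕ → Set) → ℕ → Set
IsLeast P k = P k × (∀ j → P j → k ≤ j)

module _ {P : ℕ → Set} (P? : Decidable P) where

  private
    search : ∀ m n → (∀ {j} → j < m → ¬ P j) → P (m + n) → ∃ (IsLeast P)
    search m n below p with P? m
    ... | yes pm = m , pm , λ j pj → ≮⇒≥ λ j<m → below j<m pj
    search m zero    below p | no ¬pm = contradiction (subst P (+-identityʳ m) p) ¬pm
    search m (suc n) below p | no ¬pm = search (suc m) n below′ (subst P (+-suc m n) p)
      where
      below′ : ∀ {j} → j < suc m → ¬ P j
      below′ {j} j<1+m with j ℕ.≟ m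
      ... | yes refl = ¬pm
      ... | no j≢m = below (≤∧≢⇒< (≤-pred j<1+m) j≢m)

  ∃-least : ∀ {b} → P b → ∃ (IsLeast P)
  ∃-least = search 0 _ λ ()

module _ {G : Graph} (H : Partition G) where

  quotient-adj : ∀ {u v} → adj G u v ≡ true → part H u ≢ part H v →
    adj (quotient G H) (part H u) (part H v) ≡ true
  quotient-adj {u} {v} uv pu≢pv =
    cong₂ _∧_ (cong not (==-≢ pu≢pv)) (anyFin-witness _ u (anyFin-witness _ v edge))
    where
    edge : (partSet H (part H u) u ∧ partSet H (part H v) v ∧ adj G u v) ≡ true
    edge = trans (cong₂ (λ a b → a ∧ b ∧ adj G u v) (==-refl (part H u)) (==-refl (part H v))) uv

  quotient-loopless : ∀ i → adj (quotient G H) i i ≡ false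
  quotient-loopless i rewrite ==-refl i = refl

  quotient-id-proper : IsProperColoring (quotient G H) (parts H) id
  quotient-id-proper i .i ii refl = contradiction (trans (sym ii) (quotient-loopless i)) λ ()

module _ {G : Graph} {d : ℕ} where

  exact-resp-sameClasses : ∀ {k l} {c : Fin (n G) → Fin k} {c′ : Fin (n G) → Fin l} →
    (∀ u v → c u ≡ c v ⇔ c′ u ≡ c′ v) →
    IsExactColoring G k d c → IsExactColoring G l d c′
  exact-resp-sameClasses same exact v =
    trans (count-cong λ u → cong (adj G v u ∧_) (sym (==-⇔ (same u v)))) (exact v)

  exact-resp-≗ : ∀ {k} {c c′ : Fin (n G) → Fin k} →
    c ≗ c′ → IsExactColoring G k d c → IsExactColoring G k d c′
  exact-resp-≗ c≗c′ = exact-resp-sameClasses λ u v →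
    mk⇔ (λ e → trans (sym (c≗c′ u)) (trans e (c≗c′ v)))
        (λ e → trans (c≗c′ u) (trans e (sym (c≗c′ v))))

  hasExactColoring? : ∀ k → Dec (HasExactColoring G k d)
  hasExactColoring? k = ∃-Fin→Fin? (n G) (IsExactColoring G k d) exact-resp-≗
    λ c → all? λ v → count (λ u → adj G v u ∧ (c u == c v)) ℕ.≟ d

  minimalExact-surjective : ∀ {k} (c : Fin (n G) → Fin k) → IsExactColoring G k d c →
    (∀ k′ → HasExactColoring G k′ d → k ≤ k′) → ∀ j → ∃ λ v → c v ≡ j
  minimalExact-surjective {suc k} c exact minimal j with any? (λ v → c v ≟ j)
  ... | yes hit = hit
  ... | no miss = contradiction (minimal k (squeezed , exact-resp-sameClasses same exact)) (n≮n k)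
    where
    avoids : ∀ v → j ≢ c v
    avoids v e = miss (v , sym e)

    squeezed : Fin (n G) → Fin k
    squeezed v = punchOut (avoids v)

    same : ∀ u v → c u ≡ c v ⇔ squeezed u ≡ squeezed v
    same u v = mk⇔ (punchOut-cong j) (punchOut-injective (avoids u) (avoids v))

  colourClasses : ∀ {k} (c : Fin (n G) → Fin k) → (∀ j → ∃ λ v → c v ≡ j) → Partition G
  colourClasses {k} c surjective = record { parts = k ; part = c ; nonempty = surjective }

  colourClasses-InRd : ∀ {k} {c : Fin (n G) → Fin k} (surjective : ∀ j → ∃ λ v → c v ≡ j) →
    IsExactColoring G k d c → InRd G d (colourClasses c surjective)
  colourClasses-InRd {c = c} _ exact i v v∈i = trans (count-cong inClass) (exact v)
    where
    inClass : ∀ u → ((c u == i) ∧ adj G v u) ≡ (adj G v u ∧ (c u == c v))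
    inClass u = trans (∧-comm (c u == i) (adj G v u))
                      (cong (λ j → adj G v u ∧ (c u == j)) (sym (==⇒≡ v∈i)))

  module _ (H : Partition G) where

    quotientColouring-exact : InRd G d H → ∀ {m} (col : Fin (parts H) → Fin m) →
      IsProperColoring (quotient G H) m col → IsExactColoring G m d (col ∘ part H)
    quotientColouring-exact H∈Rd col proper v =
      trans (count-cong sameColour⇔samePart) (H∈Rd (part H v) v (==-refl (part H v)))
      where
      sameColour⇔samePart : ∀ u →
        (adj G v u ∧ (col (part H u) == col (part H v))) ≡ (partSet H (part H v) u ∧ adj G v u)
      sameColour⇔samePart u with adj G v u in vu
      ... | false = sym (∧-zeroʳ _)
      ... | true  = trans (==-⇔ (mk⇔ sameColour⇒samePart (cong col))) (sym (∧-identityʳ _))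
        where
        sameColour⇒samePart : col (part H u) ≡ col (part H v) → part H u ≡ part H v
        sameColour⇒samePart e = decidable-stable (part H u ≟ part H v) λ pu≢pv →
          proper _ _ (quotient-adj H vu (pu≢pv ∘ sym)) (sym e)

    χ=≤χ[G/H] : ∀ {k m} → ExactChromaticNumberIs G d k → InRd G d H →
      HasProperColoring (quotient G H) m → k ≤ m
    χ=≤χ[G/H] (_ , minimal) H∈Rd (col , proper) =
      minimal _ (col ∘ part H , quotientColouring-exact H∈Rd col proper)

  χ=-attained : ∀ {k} → ExactChromaticNumberIs G d k →
    ∃ λ (H : Partition G) → InRd G d H × ChromaticNumberIs (quotient G H) k
  χ=-attained χ=k@((c , exact) , minimal) =
    H , H∈Rd , (id , quotient-id-proper H) , λ _ → χ=≤χ[G/H] H χ=k H∈Rd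
    where
    surjective : ∀ j → ∃ λ v → c v ≡ j
    surjective = minimalExact-surjective c exact minimal

    H : Partition G
    H = colourClasses c surjective

    H∈Rd : InRd G d H
    H∈Rd = colourClasses-InRd surjective exact

mainTheorem16 : (d : ℕ) → d ≥ 1 → (G : Graph) → IsSimple G →
    (∃ λ (H : Partition G) → InRd G d H) →
    Σ ℕ (λ k → ExactChromaticNumberIs G d k × MinQuotientChromaticIs G d k)
mainTheorem16 d _ G _ (H₀ , H₀∈Rd)
  with k , χ=k ← ∃-least (hasExactColoring? {G} {d})
                   (id ∘ part H₀ , quotientColouring-exact H₀ H₀∈Rd id (quotient-id-proper H₀))
  = k , χ=k , χ=-attained χ=k , λ H _ H∈Rd χ[G/H] → χ=≤χ[G/H] H χ=k H∈Rd (proj₁ χ[G/H])
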